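{- Let $n \geq 1$ be an integer and $p$ a prime, and let $n = n_0 + n_1 p + \dotsb + n_\ell p^\ell$ with $0 \leq n_j \leq p-1$ be the base-$p$ expansion of $n$. Then $$S_p(n) = \sum_{j=0}^{\ell} S_p(n_j),$$ where for an integer $m \geq 0$ we write $S_p(m) := \sum_{\nu \geq 1} \left\{\frac{m}{p^\nu}\right\}$.
   Context: $\{x\} = x - \lfloor x \rfloor$ denotes the fractional part. -}

module Defs where

open import Data.Nat as ℕ using (ℕ; zero; suc; _^_)
open import Data.Nat.Properties using (m^n≢0)
open import Data.Nat.Primality using (Prime; prime⇒nonZero)
open import Data.Integer as ℤ using (ℤ; +_)
open import Data.Rational as ℚ using (ℚ; 0ℚ; floor; ∣_∣; _-_; _<_; _≤_)
open import Data.Fin using (Fin; zero; suc)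
open import Data.Product using (∃; _×_)

frac : ℚ → ℚ
frac x = x - (floor x ℚ./ 1)

Sterm : (p : ℕ) → Prime p → ℕ → ℕ → ℚ
Sterm p pr m ν = frac ((+ m) ℚ./ (p ^ ν))
  where instance
    _ = prime⇒nonZero pr
    _ = m^n≢0 p ν {{prime⇒nonZero pr}}

partial₁ : (ℕ → ℚ) → ℕ → ℚ
partial₁ f zero = 0ℚ
partial₁ f (suc k) = partial₁ f k ℚ.+ f (suc k)

HasSum₁ : (ℕ → ℚ) → ℚ → Set
HasSum₁ f s = ∀ (ε : ℚ) → 0ℚ < ε → ∃ λ N → ∀ k → N ℕ.≤ k → ∣ partial₁ f k - s ∣ < ε

sumℕ : ∀ {n} → (Fin n → ℕ) → ℕ
sumℕ {zero} f = 0
sumℕ {suc n} f = f zero ℕ.+ sumℕ (λ i → f (suc i))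

sumℚ : ∀ {n} → (Fin n → ℚ) → ℚ
sumℚ {zero} f = 0ℚ
sumℚ {suc n} f = f zero ℚ.+ sumℚ (λ i → f (suc i))

-- Writing m = m' p + d with a digit d < p, one has {m / p^(ν+1)} = {m' / p^ν} + d / p^(ν+1).
-- So the k-th partial sum of S_p(m) splits into the (k-1)-th one of S_p(m') and the k-th
-- one of S_p(d), while the remainder m / ((p-1) p^k) splits the same way.  For a digit,
-- the partial sum plus this remainder is constantly d / (p-1), since {d / p^ν} = d / p^ν
-- is a geometric series.  By induction on the number of digits, for k ≥ ℓ the k-th partial
-- sum of S_p(n) is Σ n_j / (p-1) - n / ((p-1) p^k), which tends to Σ S_p(n_j).

module Submission where

open import Algebra.Bundles using (CommutativeMonoid)
open import Data.Empty using (⊥-elim)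
open import Data.Fin using (Fin; zero; suc; toℕ; fromℕ)
open import Data.Integer as ℤ using (+_; +0; +[1+_]; -[1+_])
import Data.Integer.DivMod as ℤ
import Data.Integer.Properties as ℤ
open import Data.Nat as ℕ using (ℕ; zero; suc; pred; NonZero; _*_; _^_; _<_; _≤_)
open import Data.Nat.Coprimality using (Coprime; coprime-/gcd)
import Data.Nat.DivMod as ℕ
open import Data.Nat.GCD using (gcd; gcd[m,n]∣n; gcd[m,n]≢0; n/gcd[m,n]≢0)
open import Data.Nat.Primality using (Prime; ¬prime[0]; ¬prime[1])
import Data.Nat.Properties as ℕ
open import Data.Nat.Tactic.RingSolver using (solve-∀)
open import Data.Product using (∃; _×_; _,_)
open import Data.Rational as ℚ using (ℚ; mkℚ; mkℚ+; floor; _/_)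
import Data.Rational.Properties as ℚ
open import Data.Rational.Unnormalised as ℚᵘ using (mkℚᵘ; *≡*; _≃_)
import Data.Rational.Unnormalised.Properties as ℚᵘ
open import Data.Sum using (inj₂)
open import Function using (_∘_; it)
open import Relation.Binary.PropositionalEquality

open import Algebra.Properties.AbelianGroup ℚ.+-0-abelianGroup
  using (//-rightDividesʳ; ⁻¹-anti-homo‿-; xyx⁻¹≈y)
open import Algebra.Properties.CommutativeSemigroup
  (CommutativeMonoid.commutativeSemigroup ℚ.+-0-commutativeMonoid) using (interchange)

open import Defs

toℚᵘ-/ : ∀ i n .{{_ : NonZero n}} → ℚ.toℚᵘ (i / n) ≃ mkℚᵘ i (pred n)
toℚᵘ-/ i (suc n) = ℚ.toℚᵘ-fromℚᵘ (mkℚᵘ i n)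

m*p≡o*n⇒m/n≡o/p : ∀ m n o p .{{_ : NonZero n}} .{{_ : NonZero p}} →
                  m ℕ.* p ≡ o ℕ.* n → + m / n ≡ + o / p
m*p≡o*n⇒m/n≡o/p m (suc n) o (suc p) eq = ℚ.fromℚᵘ-cong {mkℚᵘ (+ m) n} {mkℚᵘ (+ o) p} (*≡* (begin
  + m ℤ.* + suc p  ≡⟨ ℤ.pos-* m (suc p) ⟨
  + (m ℕ.* suc p)  ≡⟨ cong +_ eq ⟩
  + (o ℕ.* suc n)  ≡⟨ ℤ.pos-* o (suc n) ⟩
  + o ℤ.* + suc n  ∎))
  where open ≡-Reasoning

m/n+o/p≡[m*p+o*n]/[n*p] : ∀ m n o p .{{_ : NonZero n}} .{{_ : NonZero p}} →
  + m / n ℚ.+ + o / p ≡ (+ (m ℕ.* p ℕ.+ o ℕ.* n) / (n ℕ.* p)) {{ℕ.m*n≢0 n p}}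
m/n+o/p≡[m*p+o*n]/[n*p] m (suc n) o (suc p) = begin
  + m / suc n ℚ.+ + o / suc p
    ≡⟨ ℚ.fromℚᵘ-toℚᵘ _ ⟨
  ℚ.fromℚᵘ (ℚ.toℚᵘ (+ m / suc n ℚ.+ + o / suc p))
    ≡⟨ ℚ.fromℚᵘ-cong (ℚᵘ.≃-trans (ℚ.toℚᵘ-homo-+ (+ m / suc n) (+ o / suc p))
                                  (ℚᵘ.+-cong (toℚᵘ-/ (+ m) (suc n)) (toℚᵘ-/ (+ o) (suc p)))) ⟩
  ℚ.fromℚᵘ (mkℚᵘ (+ m) n ℚᵘ.+ mkℚᵘ (+ o) p)
    ≡⟨ cong (λ i → (i / (suc n ℕ.* suc p))) numerator ⟩
  + (m ℕ.* suc p ℕ.+ o ℕ.* suc n) / (suc n ℕ.* suc p) ∎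
  where
  open ≡-Reasoning
  numerator : + m ℤ.* + suc p ℤ.+ + o ℤ.* + suc n ≡ + (m ℕ.* suc p ℕ.+ o ℕ.* suc n)
  numerator = begin
    + m ℤ.* + suc p ℤ.+ + o ℤ.* + suc n     ≡⟨ cong₂ ℤ._+_ (ℤ.pos-* m (suc p)) (ℤ.pos-* o (suc n)) ⟨
    + (m ℕ.* suc p) ℤ.+ + (o ℕ.* suc n)     ≡⟨ ℤ.pos-+ (m ℕ.* suc p) (o ℕ.* suc n) ⟨
    + (m ℕ.* suc p ℕ.+ o ℕ.* suc n)         ∎

m/n+o/p≡r/s : ∀ m n o p r s .{{_ : NonZero n}} .{{_ : NonZero p}} .{{_ : NonZero s}} →
              (m ℕ.* p ℕ.+ o ℕ.* n) ℕ.* s ≡ r ℕ.* (n ℕ.* p) → + m / n ℚ.+ + o / p ≡ + r / s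
m/n+o/p≡r/s m n o p r s eq = trans (m/n+o/p≡[m*p+o*n]/[n*p] m n o p)
  (m*p≡o*n⇒m/n≡o/p (m ℕ.* p ℕ.+ o ℕ.* n) (n ℕ.* p) r s {{ℕ.m*n≢0 n p}} eq)

floor-mkℚ+ : ∀ m n .{{_ : NonZero n}} .(c : Coprime m n) → floor (mkℚ+ m n c) ≡ + (m ℕ./ n)
floor-mkℚ+ m (suc n) c = ℤ.div-pos-is-/ℕ (+ m) (suc n)

floor[m/n]≡m/n : ∀ m n .{{_ : NonZero n}} → floor (+ m / n) ≡ + (m ℕ./ n)
floor[m/n]≡m/n m n = begin
  floor (+ m / n)                            ≡⟨ floor-mkℚ+ (m ℕ./ g) (n ℕ./ g) (coprime-/gcd m n) ⟩
  + ((m ℕ./ g) ℕ./ (n ℕ./ g))                ≡⟨ cong +_ (ℕ.m/n/o≡m/[n*o] m g (n ℕ./ g)) ⟩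
  + (m ℕ./ (g ℕ.* (n ℕ./ g)))                ≡⟨ cong +_ (ℕ./-congʳ (ℕ.m*[n/m]≡n (gcd[m,n]∣n m n))) ⟩
  + (m ℕ./ n)                                ∎
  where
  open ≡-Reasoning
  g = gcd m n
  instance
    g≢0 : NonZero g
    g≢0 = ℕ.≢-nonZero (gcd[m,n]≢0 m n (inj₂ (ℕ.≢-nonZero⁻¹ n)))
    n/g≢0 : NonZero (n ℕ./ g)
    n/g≢0 = ℕ.≢-nonZero (n/gcd[m,n]≢0 m n {{ℕ.≢-nonZero (ℕ.≢-nonZero⁻¹ n)}})
    g*[n/g]≢0 : NonZero (g ℕ.* (n ℕ./ g))
    g*[n/g]≢0 = ℕ.m*n≢0 g (n ℕ./ g)

frac[m/n]≡[m%n]/n : ∀ m n .{{_ : NonZero n}} → frac (+ m / n) ≡ + (m ℕ.% n) / n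
frac[m/n]≡[m%n]/n m n = begin
  + m / n ℚ.- floor (+ m / n) / 1          ≡⟨ cong (λ i → + m / n ℚ.- i / 1) (floor[m/n]≡m/n m n) ⟩
  + m / n ℚ.- + q / 1                      ≡⟨ cong (ℚ._- + q / 1) m/n≡r/n+q ⟨
  (+ r / n ℚ.+ + q / 1) ℚ.- + q / 1        ≡⟨ //-rightDividesʳ (+ q / 1) (+ r / n) ⟩
  + r / n                                  ∎
  where
  open ≡-Reasoning
  q = m ℕ./ n
  r = m ℕ.% n
  m/n≡r/n+q : + r / n ℚ.+ + q / 1 ≡ + m / n
  m/n≡r/n+q = m/n+o/p≡r/s r n q 1 m n (begin
    (r ℕ.* 1 ℕ.+ q ℕ.* n) ℕ.* n  ≡⟨ cong (λ x → (x ℕ.+ q ℕ.* n) ℕ.* n) (ℕ.*-identityʳ r) ⟩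
    (r ℕ.+ q ℕ.* n) ℕ.* n        ≡⟨ cong (ℕ._* n) (ℕ.m≡m%n+[m/n]*n m n) ⟨
    m ℕ.* n                      ≡⟨ cong (m ℕ.*_) (ℕ.*-identityʳ n) ⟨
    m ℕ.* (n ℕ.* 1)              ∎)

frac[m/n]≡m/n : ∀ {m n} .{{_ : NonZero n}} → m ℕ.< n → frac (+ m / n) ≡ + m / n
frac[m/n]≡m/n {m} {n} m<n = trans (frac[m/n]≡[m%n]/n m n) (cong (λ r → + r / n) (ℕ.m<n⇒m%n≡m m<n))

frac[m/1]≡0 : ∀ m → frac (+ m / 1) ≡ ℚ.0ℚ
frac[m/1]≡0 m = trans (frac[m/n]≡[m%n]/n m 1) (cong (λ r → + r / 1) (ℕ.n%1≡0 m))

frac[[m*n+d]/[n*N]]≡frac[m/N]+d/[n*N] : ∀ m d n N .{{_ : NonZero n}} .{{_ : NonZero N}} → d ℕ.< n →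
  frac ((+ (m ℕ.* n ℕ.+ d) / (n ℕ.* N)) {{ℕ.m*n≢0 n N}})
    ≡ frac (+ m / N) ℚ.+ (+ d / (n ℕ.* N)) {{ℕ.m*n≢0 n N}}
frac[[m*n+d]/[n*N]]≡frac[m/N]+d/[n*N] m d n N d<n = begin
  frac (+ (m ℕ.* n ℕ.+ d) / (n ℕ.* N))       ≡⟨ frac[m/n]≡[m%n]/n (m ℕ.* n ℕ.+ d) (n ℕ.* N) ⟩
  + ((m ℕ.* n ℕ.+ d) ℕ.% (n ℕ.* N)) / (n ℕ.* N) ≡⟨ cong (λ r → + r / (n ℕ.* N)) remainder ⟩
  + (r ℕ.* n ℕ.+ d) / (n ℕ.* N)
    ≡⟨ m/n+o/p≡r/s r N d (n ℕ.* N) (r ℕ.* n ℕ.+ d) (n ℕ.* N) (cross r d n N) ⟨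
  + r / N ℚ.+ + d / (n ℕ.* N)               ≡⟨ cong (ℚ._+ + d / (n ℕ.* N)) (frac[m/n]≡[m%n]/n m N) ⟨
  frac (+ m / N) ℚ.+ + d / (n ℕ.* N)        ∎
  where
  open ≡-Reasoning
  instance
    n*N≢0 : NonZero (n ℕ.* N)
    n*N≢0 = ℕ.m*n≢0 n N
    N*n≢0 : NonZero (N ℕ.* n)
    N*n≢0 = ℕ.m*n≢0 N n
  r = m ℕ.% N
  cross : ∀ r d n N → (r ℕ.* (n ℕ.* N) ℕ.+ d ℕ.* N) ℕ.* (n ℕ.* N)
                      ≡ (r ℕ.* n ℕ.+ d) ℕ.* (N ℕ.* (n ℕ.* N))
  cross = solve-∀
  remainder : (m ℕ.* n ℕ.+ d) ℕ.% (n ℕ.* N) ≡ r ℕ.* n ℕ.+ d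
  remainder = begin
    (m ℕ.* n ℕ.+ d) ℕ.% (n ℕ.* N)    ≡⟨ ℕ.%-congʳ (ℕ.*-comm n N) ⟩
    (m ℕ.* n ℕ.+ d) ℕ.% (N ℕ.* n)    ≡⟨ ℕ.[m*n+o]%[p*n]≡[m*n]%[p*n]+o m N d<n ⟩
    (m ℕ.* n) ℕ.% (N ℕ.* n) ℕ.+ d    ≡⟨ cong (ℕ._+ d) (ℕ.m%n*o≡m*o%[n*o] m N n) ⟨
    r ℕ.* n ℕ.+ d                    ∎

partial₁-shift : ∀ (f g h : ℕ → ℚ) → g 0 ≡ ℚ.0ℚ → (∀ ν → f (suc ν) ≡ g ν ℚ.+ h (suc ν)) →
                 ∀ k → partial₁ f (suc k) ≡ partial₁ g k ℚ.+ partial₁ h (suc k)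
partial₁-shift f g h g0≡0 f≡g+h zero = cong (ℚ.0ℚ ℚ.+_) (trans (f≡g+h 0) (cong (ℚ._+ h 1) g0≡0))
partial₁-shift f g h g0≡0 f≡g+h (suc k) = begin
  partial₁ f (suc k) ℚ.+ f (suc (suc k))
    ≡⟨ cong₂ ℚ._+_ (partial₁-shift f g h g0≡0 f≡g+h k) (f≡g+h (suc k)) ⟩
  (partial₁ g k ℚ.+ partial₁ h (suc k)) ℚ.+ (g (suc k) ℚ.+ h (suc (suc k)))
    ≡⟨ interchange (partial₁ g k) (partial₁ h (suc k)) (g (suc k)) (h (suc (suc k))) ⟩
  partial₁ g (suc k) ℚ.+ partial₁ h (suc (suc k)) ∎
  where open ≡-Reasoning

m/n<ε-eventually : ∀ m ε → ℚ.0ℚ ℚ.< ε → ∃ λ N → ∀ n .{{_ : NonZero n}} → N ℕ.≤ n → + m / n ℚ.< ε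
m/n<ε-eventually m ε@(mkℚ +[1+ a ] b _) _ = suc (m ℕ.* suc b) , m/n<ε
  where
  m/n<ε : ∀ n .{{_ : NonZero n}} → suc (m ℕ.* suc b) ℕ.≤ n → + m / n ℚ.< ε
  m/n<ε (suc n) mb<n = ℚ.toℚᵘ-cancel-< (ℚᵘ.<-respˡ-≃ (ℚᵘ.≃-sym (toℚᵘ-/ (+ m) (suc n)))
    (ℚᵘ.*<* (subst₂ ℤ._<_ (ℤ.pos-* m (suc b)) (ℤ.pos-* (suc a) (suc n))
      (ℤ.+<+ (ℕ.<-≤-trans mb<n (ℕ.m≤n*m (suc n) (suc a)))))))
m/n<ε-eventually m (mkℚ +0 _ _) (ℚ.*<* (ℤ.+<+ ()))
m/n<ε-eventually m (mkℚ -[1+ _ ] _ _) (ℚ.*<* ())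

∣p-[p+q]∣≡∣q∣ : ∀ p q → ℚ.∣ p ℚ.- (p ℚ.+ q) ∣ ≡ ℚ.∣ q ∣
∣p-[p+q]∣≡∣q∣ p q = begin
  ℚ.∣ p ℚ.- (p ℚ.+ q) ∣       ≡⟨ cong ℚ.∣_∣ (⁻¹-anti-homo‿- (p ℚ.+ q) p) ⟨
  ℚ.∣ ℚ.- (p ℚ.+ q ℚ.- p) ∣   ≡⟨ ℚ.∣-p∣≡∣p∣ (p ℚ.+ q ℚ.- p) ⟩
  ℚ.∣ p ℚ.+ q ℚ.- p ∣         ≡⟨ cong ℚ.∣_∣ (xyx⁻¹≈y p q) ⟩
  ℚ.∣ q ∣                     ∎
  where open ≡-Reasoning

HasSum₁-by-remainder : ∀ (f : ℕ → ℚ) s m (D : ℕ → ℕ) {{_ : ∀ {k} → NonZero (D k)}} K →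
  (∀ k → k ℕ.≤ D k) → (∀ k → K ℕ.≤ k → partial₁ f k ℚ.+ + m / D k ≡ s) → HasSum₁ f s
HasSum₁-by-remainder f s m D K k≤Dk remainder ε 0<ε with m/n<ε-eventually m ε 0<ε
... | N , m/n<ε = K ℕ.+ N , λ k K+N≤k → subst (ℚ._< ε) (sym (distance k K+N≤k))
  (m/n<ε (D k) (ℕ.≤-trans (ℕ.m≤n+m N K) (ℕ.≤-trans K+N≤k (k≤Dk k))))
  where
  distance : ∀ k → K ℕ.+ N ℕ.≤ k → ℚ.∣ partial₁ f k ℚ.- s ∣ ≡ + m / D k
  distance k K+N≤k = begin
    ℚ.∣ partial₁ f k ℚ.- s ∣
      ≡⟨ cong (λ t → ℚ.∣ partial₁ f k ℚ.- t ∣) (remainder k (ℕ.≤-trans (ℕ.m≤m+n K N) K+N≤k)) ⟨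
    ℚ.∣ partial₁ f k ℚ.- (partial₁ f k ℚ.+ + m / D k) ∣
      ≡⟨ ∣p-[p+q]∣≡∣q∣ (partial₁ f k) (+ m / D k) ⟩
    ℚ.∣ + m / D k ∣
      ≡⟨ ℚ.0≤p⇒∣p∣≡p (ℚ.nonNegative⁻¹ _ {{ℚ.normalize-nonNeg m (D k)}}) ⟩
    + m / D k ∎
    where open ≡-Reasoning

sumℕ-cong : ∀ {n} {f g : Fin n → ℕ} → (∀ i → f i ≡ g i) → sumℕ f ≡ sumℕ g
sumℕ-cong {zero} f≡g = refl
sumℕ-cong {suc n} f≡g = cong₂ ℕ._+_ (f≡g zero) (sumℕ-cong (f≡g ∘ suc))

*-distribʳ-sumℕ : ∀ {n} (f : Fin n → ℕ) c → sumℕ f ℕ.* c ≡ sumℕ (λ i → f i ℕ.* c)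
*-distribʳ-sumℕ {zero} f c = refl
*-distribʳ-sumℕ {suc n} f c =
  trans (ℕ.*-distribʳ-+ c (f zero) (sumℕ (f ∘ suc))) (cong (f zero ℕ.* c ℕ.+_) (*-distribʳ-sumℕ (f ∘ suc) c))

n<m^n : ∀ {m} n → 1 ℕ.< m → n ℕ.< m ^ n
n<m^n zero 1<m = ℕ.s≤s ℕ.z≤n
n<m^n {m@(suc _)} (suc n) 1<m = begin-strict
  suc n          ≤⟨ n<m^n n 1<m ⟩
  m ^ n          <⟨ ℕ.m<m*n (m ^ n) m 1<m ⟩
  m ^ n ℕ.* m    ≡⟨ ℕ.*-comm (m ^ n) m ⟩
  m ℕ.* m ^ n    ∎
  where
  open ℕ.≤-Reasoning
  instance _ = ℕ.m^n≢0 m n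

module Digits (q : ℕ) {{_ : NonZero q}} (pr : Prime (suc q)) where

  p : ℕ
  p = suc q

  -- Instance search cannot solve NonZero (p ^ k) for an unknown k, so these are passed explicitly.
  p^≢0 : ∀ k → NonZero (p ^ k)
  p^≢0 k = ℕ.m^n≢0 p k

  q*p^≢0 : ∀ k → NonZero (q ℕ.* p ^ k)
  q*p^≢0 k = ℕ.m*n≢0 q (p ^ k) {{it}} {{p^≢0 k}}

  term : ℕ → ℕ → ℚ
  term = Sterm p pr

  -- m / ((p-1) p^k) = Σ_{ν>k} m / p^ν
  tail : ℕ → ℕ → ℚ
  tail m k = (+ m / (q ℕ.* p ^ k)) {{q*p^≢0 k}}

  partial+tail : ℕ → ℕ → ℚ
  partial+tail m k = partial₁ (term m) k ℚ.+ tail m k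

  term-digit : ∀ {d} → d ℕ.< p → ∀ ν → term d (suc ν) ≡ (+ d / p ^ suc ν) {{p^≢0 (suc ν)}}
  term-digit d<p ν = frac[m/n]≡m/n {{p^≢0 (suc ν)}} (ℕ.<-≤-trans d<p (ℕ.m≤m*n p (p ^ ν) {{p^≢0 ν}}))

  term-shift : ∀ m {d} → d ℕ.< p → ∀ ν → term (m ℕ.* p ℕ.+ d) (suc ν) ≡ term m ν ℚ.+ term d (suc ν)
  term-shift m {d} d<p ν =
    trans (frac[[m*n+d]/[n*N]]≡frac[m/N]+d/[n*N] m d p (p ^ ν) {{_}} {{p^≢0 ν}} d<p)
          (cong (term m ν ℚ.+_) (sym (term-digit d<p ν)))

  tail-step : ∀ m k → tail m k ≡ (+ m / p ^ suc k) {{p^≢0 (suc k)}} ℚ.+ tail m (suc k)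
  tail-step m k = sym (m/n+o/p≡r/s m (p ^ suc k) m (q ℕ.* p ^ suc k) m (q ℕ.* p ^ k)
    {{p^≢0 (suc k)}} {{q*p^≢0 (suc k)}} {{q*p^≢0 k}} (cross m q (p ^ k)))
    where
    cross : ∀ m q X → (m ℕ.* (q ℕ.* (suc q ℕ.* X)) ℕ.+ m ℕ.* (suc q ℕ.* X)) ℕ.* (q ℕ.* X)
                      ≡ m ℕ.* ((suc q ℕ.* X) ℕ.* (q ℕ.* (suc q ℕ.* X)))
    cross = solve-∀

  tail-shift : ∀ m d k → tail (m ℕ.* p ℕ.+ d) (suc k) ≡ tail m k ℚ.+ tail d (suc k)
  tail-shift m d k = sym (m/n+o/p≡r/s m (q ℕ.* p ^ k) d (q ℕ.* p ^ suc k) (m ℕ.* p ℕ.+ d) (q ℕ.* p ^ suc k)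
    {{q*p^≢0 k}} {{q*p^≢0 (suc k)}} {{q*p^≢0 (suc k)}} (cross m d q p (p ^ k)))
    where
    cross : ∀ m d q p X → (m ℕ.* (q ℕ.* (p ℕ.* X)) ℕ.+ d ℕ.* (q ℕ.* X)) ℕ.* (q ℕ.* (p ℕ.* X))
                          ≡ (m ℕ.* p ℕ.+ d) ℕ.* ((q ℕ.* X) ℕ.* (q ℕ.* (p ℕ.* X)))
    cross = solve-∀

  partial+tail-digit : ∀ {d} → d ℕ.< p → ∀ k → partial+tail d k ≡ + d / q
  partial+tail-digit {d} d<p zero =
    trans (ℚ.+-identityˡ _)
          (m*p≡o*n⇒m/n≡o/p d (q ℕ.* 1) d q {{q*p^≢0 0}} (cong (d ℕ.*_) (sym (ℕ.*-identityʳ q))))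
  partial+tail-digit {d} d<p (suc k) = begin
    (partial₁ (term d) k ℚ.+ term d (suc k)) ℚ.+ tail d (suc k)
      ≡⟨ ℚ.+-assoc (partial₁ (term d) k) (term d (suc k)) (tail d (suc k)) ⟩
    partial₁ (term d) k ℚ.+ (term d (suc k) ℚ.+ tail d (suc k))
      ≡⟨ cong (λ t → partial₁ (term d) k ℚ.+ (t ℚ.+ tail d (suc k))) (term-digit d<p k) ⟩
    partial₁ (term d) k ℚ.+ ((+ d / p ^ suc k) {{p^≢0 (suc k)}} ℚ.+ tail d (suc k))
      ≡⟨ cong (partial₁ (term d) k ℚ.+_) (tail-step d k) ⟨
    partial+tail d k
      ≡⟨ partial+tail-digit d<p k ⟩
    + d / q ∎
    where open ≡-Reasoning

  partial+tail-shift : ∀ m {d} → d ℕ.< p → ∀ k →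
                       partial+tail (m ℕ.* p ℕ.+ d) (suc k) ≡ partial+tail m k ℚ.+ partial+tail d (suc k)
  partial+tail-shift m {d} d<p k = begin
    partial₁ (term (m ℕ.* p ℕ.+ d)) (suc k) ℚ.+ tail (m ℕ.* p ℕ.+ d) (suc k)
      ≡⟨ cong₂ ℚ._+_ (partial₁-shift _ (term m) (term d) (frac[m/1]≡0 m) (term-shift m d<p) k)
                     (tail-shift m d k) ⟩
    (partial₁ (term m) k ℚ.+ partial₁ (term d) (suc k)) ℚ.+ (tail m k ℚ.+ tail d (suc k))
      ≡⟨ interchange (partial₁ (term m) k) (partial₁ (term d) (suc k)) (tail m k) (tail d (suc k)) ⟩
    partial+tail m k ℚ.+ partial+tail d (suc k) ∎
    where open ≡-Reasoning

  fromDigits : ∀ {n} → (Fin n → ℕ) → ℕ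
  fromDigits d = sumℕ (λ j → d j ℕ.* p ^ toℕ j)

  fromDigits-suc : ∀ {n} (d : Fin (suc n) → ℕ) → fromDigits d ≡ fromDigits (d ∘ suc) ℕ.* p ℕ.+ d zero
  fromDigits-suc d = begin
    d zero ℕ.* 1 ℕ.+ sumℕ (λ j → d (suc j) ℕ.* (p ℕ.* p ^ toℕ j))
      ≡⟨ ℕ.+-comm (d zero ℕ.* 1) _ ⟩
    sumℕ (λ j → d (suc j) ℕ.* (p ℕ.* p ^ toℕ j)) ℕ.+ d zero ℕ.* 1
      ≡⟨ cong₂ ℕ._+_ (sym (trans (*-distribʳ-sumℕ (λ j → d (suc j) ℕ.* p ^ toℕ j) p) (sumℕ-cong shift)))
                     (ℕ.*-identityʳ (d zero)) ⟩
    fromDigits (d ∘ suc) ℕ.* p ℕ.+ d zero ∎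
    where
    open ≡-Reasoning
    shift : ∀ j → d (suc j) ℕ.* p ^ toℕ j ℕ.* p ≡ d (suc j) ℕ.* (p ℕ.* p ^ toℕ j)
    shift j = trans (ℕ.*-assoc (d (suc j)) _ p) (cong (d (suc j) ℕ.*_) (ℕ.*-comm (p ^ toℕ j) p))

  partial+tail-fromDigits : ∀ ℓ (d : Fin (suc ℓ) → ℕ) → (∀ j → d j ℕ.< p) →
                            ∀ k → ℓ ℕ.≤ k → partial+tail (fromDigits d) k ≡ sumℚ (λ j → + d j / q)
  partial+tail-fromDigits zero d d<p k _ = begin
    partial+tail (d zero ℕ.* 1 ℕ.+ 0) k
      ≡⟨ cong (λ m → partial+tail m k) (trans (ℕ.+-identityʳ _) (ℕ.*-identityʳ (d zero))) ⟩
    partial+tail (d zero) k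
      ≡⟨ partial+tail-digit (d<p zero) k ⟩
    + d zero / q
      ≡⟨ ℚ.+-identityʳ (+ d zero / q) ⟨
    + d zero / q ℚ.+ ℚ.0ℚ ∎
    where open ≡-Reasoning
  partial+tail-fromDigits (suc ℓ) d d<p (suc k) (ℕ.s≤s ℓ≤k) = begin
    partial+tail (fromDigits d) (suc k)
      ≡⟨ cong (λ m → partial+tail m (suc k)) (fromDigits-suc d) ⟩
    partial+tail (fromDigits (d ∘ suc) ℕ.* p ℕ.+ d zero) (suc k)
      ≡⟨ partial+tail-shift (fromDigits (d ∘ suc)) (d<p zero) k ⟩
    partial+tail (fromDigits (d ∘ suc)) k ℚ.+ partial+tail (d zero) (suc k)
      ≡⟨ cong₂ ℚ._+_ (partial+tail-fromDigits ℓ (d ∘ suc) (d<p ∘ suc) k ℓ≤k)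
                     (partial+tail-digit (d<p zero) (suc k)) ⟩
    sumℚ (λ j → + d (suc j) / q) ℚ.+ + d zero / q
      ≡⟨ ℚ.+-comm (sumℚ (λ j → + d (suc j) / q)) (+ d zero / q) ⟩
    sumℚ (λ j → + d j / q) ∎
    where open ≡-Reasoning

  k≤q*p^k : ∀ k → k ℕ.≤ q ℕ.* p ^ k
  k≤q*p^k k = ℕ.≤-trans (ℕ.<⇒≤ (n<m^n k (ℕ.s≤s (ℕ.>-nonZero⁻¹ q)))) (ℕ.m≤n*m (p ^ k) q)

  HasSum₁-partial+tail : ∀ m s K → (∀ k → K ℕ.≤ k → partial+tail m k ≡ s) → HasSum₁ (term m) s
  HasSum₁-partial+tail m s K =
    HasSum₁-by-remainder (term m) s m (λ k → q ℕ.* p ^ k) {{λ {k} → q*p^≢0 k}} K k≤q*p^k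

lemma3 : (n p : ℕ) (pr : Prime p) → 1 ≤ n →
  (ℓ : ℕ) (d : Fin (suc ℓ) → ℕ) →
  (∀ j → d j < p) → 1 ≤ d (fromℕ ℓ) →
  n ≡ sumℕ (λ j → d j * p ^ toℕ j) →
  ∃ λ (t : Fin (suc ℓ) → ℚ) →
    (∀ j → HasSum₁ (Sterm p pr (d j)) (t j)) ×
    HasSum₁ (Sterm p pr n) (sumℚ t)
-- The hypotheses 1 ≤ n and n_ℓ ≥ 1 only make the expansion canonical.
lemma3 n zero pr = ⊥-elim (¬prime[0] pr)
lemma3 n (suc zero) pr = ⊥-elim (¬prime[1] pr)
lemma3 _ (suc q@(suc _)) pr _ ℓ d d<p _ refl =
  (λ j → + d j / q) ,
  (λ j → HasSum₁-partial+tail (d j) (+ d j / q) 0 (λ k _ → partial+tail-digit (d<p j) k)) ,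
  HasSum₁-partial+tail (fromDigits d) _ ℓ (partial+tail-fromDigits ℓ d d<p)
  where open Digits q pr
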